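{- Define $h:\mathbb N\to\mathbb N$ by $$h(n)=\begin{cases}\lfloor\varphi n\rfloor,& n\in R_{2,0}\cup R_{1,0},\\ \lfloor(\varphi-1)n+2\rfloor,& n\in R_{2,2},\\ \lfloor(\varphi-1)n-1\rfloor,& n\in R_{3,1}.\end{cases}$$ Then $h$ is a permutation of $\mathbb N$ of order $4$ (i.e. $h^4=\mathrm{id}$ and $h^2\neq\mathrm{id}$). Moreover $$h^2(n)=\begin{cases}\lfloor(\varphi+1)n-1\rfloor,& n\in R_{1,0},\\ n+2,& n\in R_{2,2},\\ n-2,& n\in R_{2,0},\\ \lfloor(2-\varphi)n+1\rfloor,& n\in R_{3,1},\end{cases} \qquad h^{3}(n)=h^{ -1}(n)=\begin{cases}\lfloor\varphi n+3\rfloor,& n\in R_{2,2},\\ \lfloor\varphi n-2\rfloor,& n\in R_{1,0},\\ \lfloor(\varphi-1)n+1\rfloor,& n\in R_{3,1}\cup R_{2,0}.\end{cases}$$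
   Context: Let $\varphi=\frac{1+\sqrt5}{2}$ and $\mathbb N=\{1,2,3,\dots\}$; $a(n)=\lfloor n\varphi\rfloor$. $F$ is the Fibonacci sequence, $F(0)=0$, $F(1)=F(2)=1$, $F(n)=F(n-1)+F(n-2)$. For $i\in\mathbb Z^{\geq0}$, $j\in\mathbb Z$, let $f_{i,j}(n)=F(i+1)a(n)+F(i)n-j$ ($n\in\mathbb N$) and $R_{i,j}=\{f_{i,j}(n)\mid n\in\mathbb N\}$. The sets $R_{1,0},R_{2,0},R_{2,2},R_{3,1}$ form a partition of $\mathbb N$. Powers denote iterated composition. -}

module Defs where

open import Data.Nat as ℕ using (ℕ; zero; suc)
open import Data.Integer as ℤ using (ℤ; +_; -[1+_]; _+_; _*_; _-_; -_)
open import Data.Integer.DivMod using (_/_)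
open import Data.Bool using (if_then_else_)
open import Data.Product using (Σ; _×_)
open import Relation.Binary.PropositionalEquality using (_≡_)

isqrt : ℕ → ℕ
isqrt zero = zero
isqrt (suc m) with isqrt m
... | r = if (suc r ℕ.* suc r) ℕ.≤ᵇ suc m then suc r else r

-- ⌊ v * √5 ⌋ for an integer v  (√5 irrational, so for v < 0 this is
-- - ⌈ |v| √5 ⌉ = - ⌊ |v| √5 ⌋ - 1).
floorSqrt5 : ℤ → ℤ
floorSqrt5 (+ n)     = + isqrt (5 ℕ.* (n ℕ.* n))
floorSqrt5 -[1+ k ]  = - (+ isqrt (5 ℕ.* (suc k ℕ.* suc k))) - + 1

-- ⌊ v * φ ⌋ = ⌊ (v + v√5) / 2 ⌋ = ⌊ (v + ⌊v√5⌋) / 2 ⌋ ; integer division by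
-- a positive divisor in Data.Integer.DivMod is floor division.
floorVφ : ℤ → ℤ
floorVφ v = (v + floorSqrt5 v) / + 2

⌊_+_φ⌋ : ℤ → ℤ → ℤ
⌊ u + v φ⌋ = u + floorVφ v

F : ℕ → ℕ
F zero = zero
F (suc zero) = suc zero
F (suc (suc n)) = F (suc n) ℕ.+ F n

a : ℕ → ℤ
a n = ⌊ + 0 + + n φ⌋

f : ℕ → ℤ → ℕ → ℤ
f i j n = + F (suc i) * a n + + F i * + n - j

R : ℕ → ℤ → ℤ → Set
R i j m = Σ ℕ (λ n → (1 ℕ.≤ n) × (f i j n ≡ m))

_^_ : (ℕ → ℕ) → ℕ → (ℕ → ℕ)
(g ^ zero) x = x
(g ^ suc k) x = g ((g ^ k) x)

-- ⌊vφ⌋ is characterised by the sign of the norm N x v = x² - xv - v², which never vanishes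
-- off the origin since φ is irrational. This turns the classical identities
-- ⌊⌊vφ⌋φ⌋ = ⌊vφ⌋ + v - 1, ⌊(⌊vφ⌋ + v)φ⌋ = 2⌊vφ⌋ + v, ⌊-vφ⌋ = -⌊vφ⌋ - 1 and Beatty's
-- complementarity of ⌊ℕ⁺φ⌋ and ⌊ℕ⁺φ²⌋ into polynomial sign certificates. With a = ⌊kφ⌋ the
-- four sets consist of a + k, 2a + k, 3a + 2k - 1 and 2a + k - 2, they cover ℕ⁺, and
-- evaluating the defining formula of h on them shows
-- f₁₀(k) ↦ f₂₀(k) ↦ f₃₁(k) ↦ f₂₂(k) ↦ f₁₀(k). So every orbit of h is a 4-cycle.

module Submission where

open import Defs
open import Data.Nat using (ℕ; _≤_)
open import Data.Integer using (ℤ; +_; _-_; -_)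
open import Data.Product using (Σ; _×_)
open import Data.Sum using (_⊎_)
open import Relation.Binary.PropositionalEquality using (_≡_; _≢_)

open import Data.Nat as ℕ using (zero; suc; z≤n; s≤s)
import Data.Nat.Properties as ℕP
open import Data.Integer as ℤ using (_+_; _*_; -[1+_]; 0ℤ; 1ℤ; +≤+; +<+)
import Data.Integer.Properties as ℤP
open import Data.Integer.DivMod using (_/_; [n/d]*d≤n; n<s[n/ℕd]*d; div-pos-is-/ℕ)
open import Data.Integer.Tactic.RingSolver using (solve-∀)
open import Data.Bool using (true; false; T)
open import Data.Unit using (tt)
open import Data.Empty using (⊥; ⊥-elim)
open import Data.Sum using (inj₁; inj₂)
open import Data.Product using (_,_; proj₁; proj₂)
open import Relation.Nullary using (Dec; yes; no)
open import Relation.Binary.PropositionalEquality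
  using (refl; sym; trans; cong; cong₂; subst; subst₂; module ≡-Reasoning)

isqrt-bounds : ∀ m → isqrt m ℕ.* isqrt m ≤ m × m ℕ.< suc (isqrt m) ℕ.* suc (isqrt m)
isqrt-bounds zero = z≤n , s≤s z≤n
isqrt-bounds (suc m) with isqrt m | isqrt-bounds m
... | r | r²≤m , m<[r+1]² with (suc r ℕ.* suc r) ℕ.≤ᵇ suc m in step
... | true  = ℕP.≤ᵇ⇒≤ (suc r ℕ.* suc r) (suc m) (subst T (sym step) tt)
            , ℕP.≤-trans (s≤s m<[r+1]²) (ℕP.*-mono-< (ℕP.n<1+n (suc r)) (ℕP.n<1+n (suc r)))
... | false = ℕP.≤-trans r²≤m (ℕP.n≤1+n m) , ℕP.≰⇒> (λ le → subst T step (ℕP.≤⇒≤ᵇ le))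

1≤isqrt : ∀ m → 1 ≤ isqrt (suc m)
1≤isqrt m with isqrt (suc m) | isqrt-bounds (suc m)
... | zero  | _ , s≤s ()
... | suc r | _ = s≤s z≤n

-- Sign certificates: to refute a system of integer inequalities, exhibit a sum of
-- products of quantities known to be nonnegative that the ring solver shows to be negative.

0≤+ : ∀ n → 0ℤ ℤ.≤ + n
0≤+ n = +≤+ z≤n

0≤-+ : ∀ {x y} → 0ℤ ℤ.≤ x → 0ℤ ℤ.≤ y → 0ℤ ℤ.≤ x + y
0≤-+ = ℤP.+-mono-≤

0≤-* : ∀ {x y} → 0ℤ ℤ.≤ x → 0ℤ ℤ.≤ y → 0ℤ ℤ.≤ x * y
0≤-* {+ m} {+ n} _ _ = subst (0ℤ ℤ.≤_) (ℤP.pos-* m n) (0≤+ _)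

0≤-≡ : ∀ {x y} → x ≡ y → 0ℤ ℤ.≤ x → 0ℤ ℤ.≤ y
0≤-≡ eq = subst (0ℤ ℤ.≤_) eq

0≤-refute : ∀ {e n} → 0ℤ ℤ.≤ e → e ≢ -[1+ n ]
0≤-refute () refl

<⇒0≤ : ∀ {x y} → x ℤ.< y → 0ℤ ℤ.≤ y - x - 1ℤ
<⇒0≤ {x} {y} x<y = 0≤-≡ (shift y x) (ℤP.i≤j⇒0≤j-i (ℤP.i<j⇒suc[i]≤j x<y))
  where
  shift : ∀ y x → y - (1ℤ + x) ≡ y - x - 1ℤ
  shift = solve-∀

0≤⇒< : ∀ {x y} → 0ℤ ℤ.≤ y - x - 1ℤ → x ℤ.< y
0≤⇒< {x} {y} 0≤d = ℤP.i≤pred[j]⇒i<j (ℤP.0≤i-j⇒j≤i (0≤-≡ (shift y x) 0≤d))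
  where
  shift : ∀ y x → y - x - 1ℤ ≡ (- 1ℤ + y) - x
  shift = solve-∀

<⇒0<- : ∀ {x y} → x ℤ.< y → 0ℤ ℤ.< y - x
<⇒0<- {x} {y} x<y = 0≤⇒< (0≤-≡ (shift y x) (<⇒0≤ x<y))
  where
  shift : ∀ y x → y - x - 1ℤ ≡ (y - x) - 0ℤ - 1ℤ
  shift = solve-∀

-- N x y = (x - yφ)(x + y/φ) is the norm of x - yφ in ℤ[φ].
N : ℤ → ℤ → ℤ
N x y = x * x - x * y - y * y

N-descent : ∀ x y → N y (x - y) ≡ - N x y
N-descent = identity
  where
  identity : ∀ x y → y * y - y * (x - y) - (x - y) * (x - y) ≡ - (x * x - x * y - y * y)
  identity = solve-∀

N≡0⇒< : ∀ {x y} → 0ℤ ℤ.≤ x → 0ℤ ℤ.< y → N x y ≡ 0ℤ → y ℤ.< x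
N≡0⇒< {x} {y} 0≤x 0<y root with y ℤ.<? x
... | yes y<x = y<x
... | no  y≮x = ⊥-elim (0≤-refute
  (0≤-+ (0≤-* 0≤x (ℤP.i≤j⇒0≤j-i (ℤP.≮⇒≥ y≮x))) (0≤-* (<⇒0≤ 0<y) (0≤-+ (<⇒0≤ 0<y) (0≤+ 2))))
  (trans (certificate x y) (cong (λ t → - t - 1ℤ) root)))
  where
  certificate : ∀ x y →
    x * (y - x) + (y - 0ℤ - 1ℤ) * (y - 0ℤ - 1ℤ + + 2) ≡ - (x * x - x * y - y * y) - 1ℤ
  certificate = solve-∀

-- φ is irrational: descend along (x, y) ↦ (y, x - y), which keeps N = 0 up to sign.
N≢0 : ∀ {x y} → 0ℤ ℤ.≤ x → 0ℤ ℤ.< y → N x y ≢ 0ℤ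
N≢0 {x} {+ n} 0≤x 0<y = descent n ℤP.≤-refl 0≤x 0<y
  where
  descent : ∀ bound {x y} → y ℤ.≤ + bound → 0ℤ ℤ.≤ x → 0ℤ ℤ.< y → N x y ≢ 0ℤ
  descent zero    y≤0 _ 0<y _ = ℤP.<-irrefl refl (ℤP.<-≤-trans 0<y y≤0)
  descent (suc b) {x} {y} y≤b+1 0≤x 0<y root =
    descent b (ℤP.i<j⇒i≤pred[j] (ℤP.<-≤-trans x-y<y y≤b+1)) (ℤP.<⇒≤ 0<y) 0<x-y root′
    where
    root′ : N y (x - y) ≡ 0ℤ
    root′ = trans (N-descent x y) (cong -_ root)
    0<x-y : 0ℤ ℤ.< x - y
    0<x-y = <⇒0<- (N≡0⇒< 0≤x 0<y root)
    x-y<y : x - y ℤ.< y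
    x-y<y = N≡0⇒< (ℤP.<⇒≤ 0<y) 0<x-y root′

-- For v > 0 this says exactly m < vφ < m + 1.
IsFloorφ : ℤ → ℤ → Set
IsFloorφ v m = N m v ℤ.< 0ℤ × 0ℤ ℤ.< N (m + 1ℤ) v

IsFloorφ-unique : ∀ {v m m′} → IsFloorφ v m → IsFloorφ v m′ → m ≡ m′
IsFloorφ-unique p p′ = ℤP.≤-antisym (ℤP.≮⇒≥ (ordered p′ p)) (ℤP.≮⇒≥ (ordered p p′))
  where
  ordered : ∀ {v m m′} → IsFloorφ v m → IsFloorφ v m′ → m ℤ.< m′ → ⊥
  ordered {v} {m} {m′} (m<vφ , vφ<m+1) (m′<vφ , _) m<m′ =
    0≤-refute (0≤-+ (0≤-+ A B) (0≤-* d (0≤-+ (0≤-+ (0≤-+ d B) C) (0≤+ 3))))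
              (certificate v m m′)
    where
    A : 0ℤ ℤ.≤ 0ℤ - N m′ v - 1ℤ
    A = <⇒0≤ m′<vφ
    B : 0ℤ ℤ.≤ N (m + 1ℤ) v - 0ℤ - 1ℤ
    B = <⇒0≤ vφ<m+1
    C : 0ℤ ℤ.≤ 0ℤ - N m v - 1ℤ
    C = <⇒0≤ m<vφ
    d : 0ℤ ℤ.≤ m′ - m - 1ℤ
    d = <⇒0≤ m<m′
    certificate : ∀ v m m′ →
      let A = 0ℤ - (m′ * m′ - m′ * v - v * v) - 1ℤ
          B = (m + 1ℤ) * (m + 1ℤ) - (m + 1ℤ) * v - v * v - 0ℤ - 1ℤ
          C = 0ℤ - (m * m - m * v - v * v) - 1ℤ
          d = m′ - m - 1ℤ
      in A + B + d * (d + B + C + + 3) ≡ - + 2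
    certificate = solve-∀

IsFloorφ⇒≤ : ∀ {v m} → 0ℤ ℤ.≤ v → 0ℤ ℤ.≤ m → IsFloorφ v m → v ℤ.≤ m
IsFloorφ⇒≤ {v} {m} 0≤v 0≤m (_ , vφ<m+1) = ℤP.≮⇒≥ λ m<v →
  0≤-refute (0≤-+ (0≤-+ (<⇒0≤ vφ<m+1) (0≤-* (<⇒0≤ m<v) (0≤-+ 0≤m (0≤+ 1)))) (0≤-* 0≤v 0≤v))
            (certificate v m)
  where
  certificate : ∀ v m →
    ((m + 1ℤ) * (m + 1ℤ) - (m + 1ℤ) * v - v * v - 0ℤ - 1ℤ) + (v - m - 1ℤ) * (m + 1ℤ) + v * v
      ≡ - 1ℤ
  certificate = solve-∀

IsFloorφ⇒<2* : ∀ {v m} → 0ℤ ℤ.≤ v → IsFloorφ v m → m ℤ.< v + v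
IsFloorφ⇒<2* {v} {m} 0≤v (m<vφ , _) with m ℤ.<? v + v
... | yes m<2v = m<2v
... | no  m≮2v = ⊥-elim
  (0≤-refute (0≤-+ (0≤-+ (0≤-+ (<⇒0≤ m<vφ) (0≤-* 0≤v 0≤v)) (0≤-* (0≤-* (0≤+ 3) e) 0≤v)) (0≤-* e e))
             (certificate v m))
  where
  e : 0ℤ ℤ.≤ m - (v + v)
  e = ℤP.i≤j⇒0≤j-i (ℤP.≮⇒≥ m≮2v)
  certificate : ∀ v m →
    (0ℤ - (m * m - m * v - v * v) - 1ℤ) + v * v + + 3 * (m - (v + v)) * v + (m - (v + v)) * (m - (v + v))
      ≡ - 1ℤ
  certificate = solve-∀

/2-bounds : ∀ X → (X / + 2) * + 2 ℤ.≤ X × X ℤ.< (1ℤ + X / + 2) * + 2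
/2-bounds X = [n/d]*d≤n X (+ 2)
            , subst (λ q → X ℤ.< (1ℤ + q) * + 2) (sym (div-pos-is-/ℕ X 2)) (n<s[n/ℕd]*d X 2)

-- With s = ⌊v√5⌋ and q = ⌊(v + s)/2⌋, the number D = 2q - v is s - 1 or s, and
-- 4 N q v = D² - 5v², 4 N (q + 1) v = (D + 2)² - 5v².
IsFloorφ-from-√5 : ∀ {v s q} → 0ℤ ℤ.< v → 0ℤ ℤ.< s →
  s * s ℤ.≤ + 5 * (v * v) → + 5 * (v * v) ℤ.< (1ℤ + s) * (1ℤ + s) →
  q * + 2 ℤ.≤ v + s → v + s ℤ.< (1ℤ + q) * + 2 →
  0ℤ ℤ.≤ q × IsFloorφ v q
IsFloorφ-from-√5 {v} {s} {q} 0<v 0<s s²≤5v² 5v²<[s+1]² 2q≤v+s v+s<2q+2 =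
  0≤q , Nqv<0 , 0<N[q+1]v
  where
  D≤s : 0ℤ ℤ.≤ s - (q + q - v)
  D≤s = 0≤-≡ (identity v s q) (ℤP.i≤j⇒0≤j-i 2q≤v+s)
    where
    identity : ∀ v s q → v + s - q * + 2 ≡ s - (q + q - v)
    identity = solve-∀
  s≤D+1 : 0ℤ ℤ.≤ (q + q - v) + 1ℤ - s
  s≤D+1 = 0≤-≡ (identity v s q) (<⇒0≤ v+s<2q+2)
    where
    identity : ∀ v s q → (1ℤ + q) * + 2 - (v + s) - 1ℤ ≡ (q + q - v) + 1ℤ - s
    identity = solve-∀
  0≤D : 0ℤ ℤ.≤ q + q - v
  0≤D = 0≤-≡ (identity v s q) (0≤-+ s≤D+1 (<⇒0≤ 0<s))
    where
    identity : ∀ v s q → (q + q - v) + 1ℤ - s + (s - 0ℤ - 1ℤ) ≡ q + q - v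
    identity = solve-∀
  0≤q : 0ℤ ℤ.≤ q
  0≤q = ℤP.*-cancelˡ-≤-pos 0ℤ q (+ 2) (0≤-≡ (identity v q) (0≤-+ 0≤D (ℤP.<⇒≤ 0<v)))
    where
    identity : ∀ v q → q + q - v + v ≡ + 2 * q
    identity = solve-∀
  0≤-N : 0ℤ ℤ.≤ - N q v
  0≤-N = ℤP.*-cancelˡ-≤-pos 0ℤ (- N q v) (+ 4)
    (0≤-≡ (identity v s q)
      (0≤-+ (ℤP.i≤j⇒0≤j-i s²≤5v²) (0≤-* D≤s (0≤-+ (ℤP.<⇒≤ 0<s) 0≤D))))
    where
    identity : ∀ v s q →
      + 5 * (v * v) - s * s + (s - (q + q - v)) * (s + (q + q - v)) ≡ + 4 * - (q * q - q * v - v * v)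
    identity = solve-∀
  Nqv<0 : N q v ℤ.< 0ℤ
  Nqv<0 = subst (ℤ._< 0ℤ) (ℤP.neg-involutive (N q v))
    (ℤP.neg-mono-< (ℤP.≤∧≢⇒< 0≤-N (λ 0≡-N → N≢0 0≤q 0<v
      (trans (sym (ℤP.neg-involutive (N q v))) (cong -_ (sym 0≡-N))))))
  0<N[q+1]v : 0ℤ ℤ.< N (q + 1ℤ) v
  0<N[q+1]v = ℤP.*-cancelˡ-<-nonNeg (+ 4) (0≤⇒<
    (0≤-≡ (identity v s q)
      (0≤-+ (0≤-* s≤D+1 (0≤-+ (0≤-+ 0≤D (ℤP.<⇒≤ 0<s)) (0≤+ 3))) (<⇒0≤ 5v²<[s+1]²))))
    where
    identity : ∀ v s q →
      ((q + q - v) + 1ℤ - s) * ((q + q - v) + s + + 3) + ((1ℤ + s) * (1ℤ + s) - + 5 * (v * v) - 1ℤ)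
        ≡ + 4 * ((q + 1ℤ) * (q + 1ℤ) - (q + 1ℤ) * v - v * v) - 0ℤ - 1ℤ
    identity = solve-∀

floorVφ-spec : ∀ {v} → 0ℤ ℤ.< v → 0ℤ ℤ.≤ floorVφ v × IsFloorφ v (floorVφ v)
floorVφ-spec {+ zero} (+<+ ())
floorVφ-spec {+ suc k} _ =
  IsFloorφ-from-√5 (+<+ (s≤s z≤n)) (+<+ (1≤isqrt (ℕ.pred 5k²)))
    (subst₂ ℤ._≤_ (ℤP.pos-* s s) 5v² (+≤+ (proj₁ (isqrt-bounds 5k²))))
    (subst₂ ℤ._<_ 5v² (ℤP.pos-* (suc s) (suc s)) (+<+ (proj₂ (isqrt-bounds 5k²))))
    (proj₁ (/2-bounds (+ suc k + + s))) (proj₂ (/2-bounds (+ suc k + + s)))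
  where
  5k² s : ℕ
  5k² = 5 ℕ.* (suc k ℕ.* suc k)
  s = isqrt 5k²
  5v² : + 5k² ≡ + 5 * (+ suc k * + suc k)
  5v² = trans (ℤP.pos-* 5 (suc k ℕ.* suc k)) (cong (+ 5 *_) (ℤP.pos-* (suc k) (suc k)))

floorVφ-unique : ∀ {v m} → 0ℤ ℤ.< v → IsFloorφ v m → floorVφ v ≡ m
floorVφ-unique 0<v = IsFloorφ-unique (proj₂ (floorVφ-spec 0<v))

≤floorVφ : ∀ {v} → 0ℤ ℤ.< v → v ℤ.≤ floorVφ v
≤floorVφ 0<v = IsFloorφ⇒≤ (ℤP.<⇒≤ 0<v) (proj₁ (floorVφ-spec 0<v)) (proj₂ (floorVφ-spec 0<v))

floorVφ<2* : ∀ {v} → 0ℤ ℤ.< v → floorVφ v ℤ.< v + v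
floorVφ<2* 0<v = IsFloorφ⇒<2* (ℤP.<⇒≤ 0<v) (proj₂ (floorVφ-spec 0<v))

0<floorVφ : ∀ {v} → 0ℤ ℤ.< v → 0ℤ ℤ.< floorVφ v
0<floorVφ 0<v = ℤP.<-≤-trans 0<v (≤floorVφ 0<v)

-- Stated for any x equal to ⌊yφ⌋ so that they can be chained.
floorVφ-compose : ∀ {y x} → 0ℤ ℤ.< y → floorVφ y ≡ x → floorVφ x ≡ x + y - 1ℤ
floorVφ-compose {y} 0<y refl = floorVφ-unique (0<floorVφ 0<y) (Nx<0 , 0<N[x+1])
  where
  x : ℤ
  x = floorVφ y
  spec : IsFloorφ y x
  spec = proj₂ (floorVφ-spec 0<y)
  Nx<0 : N (x + y - 1ℤ) x ℤ.< 0ℤ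
  Nx<0 = 0≤⇒< (0≤-≡ (identity x y)
    (0≤-+ (0≤-+ (<⇒0≤ (proj₂ spec)) (<⇒0≤ (floorVφ<2* 0<y))) (<⇒0≤ 0<y)))
    where
    identity : ∀ x y →
      ((x + 1ℤ) * (x + 1ℤ) - (x + 1ℤ) * y - y * y - 0ℤ - 1ℤ) + (y + y - x - 1ℤ) + (y - 0ℤ - 1ℤ)
        ≡ 0ℤ - ((x + y - 1ℤ) * (x + y - 1ℤ) - (x + y - 1ℤ) * x - x * x) - 1ℤ
    identity = solve-∀
  0<N[x+1] : 0ℤ ℤ.< N (x + y - 1ℤ + 1ℤ) x
  0<N[x+1] = 0≤⇒< (0≤-≡ (identity x y) (<⇒0≤ (proj₁ spec)))
    where
    identity : ∀ x y →
      0ℤ - (x * x - x * y - y * y) - 1ℤ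
        ≡ (x + y - 1ℤ + 1ℤ) * (x + y - 1ℤ + 1ℤ) - (x + y - 1ℤ + 1ℤ) * x - x * x - 0ℤ - 1ℤ
    identity = solve-∀

floorVφ-shift : ∀ {y x} → 0ℤ ℤ.< y → floorVφ y ≡ x → floorVφ (x + y) ≡ + 2 * x + y
floorVφ-shift {y} 0<y refl = floorVφ-unique (ℤP.+-mono-< (0<floorVφ 0<y) 0<y) (Nx<0 , 0<N[x+1])
  where
  x : ℤ
  x = floorVφ y
  spec : IsFloorφ y x
  spec = proj₂ (floorVφ-spec 0<y)
  Nx<0 : N (+ 2 * x + y) (x + y) ℤ.< 0ℤ
  Nx<0 = subst (ℤ._< 0ℤ) (identity x y) (proj₁ spec)
    where
    identity : ∀ x y →
      x * x - x * y - y * y ≡ (+ 2 * x + y) * (+ 2 * x + y) - (+ 2 * x + y) * (x + y) - (x + y) * (x + y)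
    identity = solve-∀
  0<N[x+1] : 0ℤ ℤ.< N (+ 2 * x + y + 1ℤ) (x + y)
  0<N[x+1] = 0≤⇒< (0≤-≡ (identity x y)
    (0≤-+ (0≤-+ (<⇒0≤ (proj₂ spec)) (proj₁ (floorVφ-spec 0<y))) (0≤-* (0≤+ 2) (ℤP.<⇒≤ 0<y))))
    where
    identity : ∀ x y →
      ((x + 1ℤ) * (x + 1ℤ) - (x + 1ℤ) * y - y * y - 0ℤ - 1ℤ) + x + + 2 * y
        ≡ (+ 2 * x + y + 1ℤ) * (+ 2 * x + y + 1ℤ) - (+ 2 * x + y + 1ℤ) * (x + y) - (x + y) * (x + y) - 0ℤ - 1ℤ
    identity = solve-∀

/2-unique : ∀ {X q} → q * + 2 ℤ.≤ X → X ℤ.< (1ℤ + q) * + 2 → X / + 2 ≡ q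
/2-unique {X} lo hi = ℤP.≤-antisym (below (proj₁ (/2-bounds X)) hi) (below lo (proj₂ (/2-bounds X)))
  where
  below : ∀ {q r} → q * + 2 ℤ.≤ X → X ℤ.< (1ℤ + r) * + 2 → q ℤ.≤ r
  below {q} {r} lo hi = subst (q ℤ.≤_) (ℤP.pred-suc r)
    (ℤP.i<j⇒i≤pred[j] (ℤP.*-cancelʳ-<-nonNeg {j = 1ℤ + r} (+ 2) (ℤP.≤-<-trans lo hi)))

-- As v√5 is irrational, ⌊-v√5⌋ = -⌊v√5⌋ - 1, so for X = v + ⌊v√5⌋ the claim reads
-- ⌊(-X - 1)/2⌋ = -⌊X/2⌋ - 1.
floorVφ-neg : ∀ {v} → 0ℤ ℤ.< v → floorVφ (- v) ≡ - floorVφ v - 1ℤ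
floorVφ-neg {+ zero} (+<+ ())
floorVφ-neg {+ suc k} _ = /2-unique
  (ℤP.0≤i-j⇒j≤i (0≤-≡ (lower (+ suc k) (+ s) q) (<⇒0≤ (proj₂ (/2-bounds X)))))
  (0≤⇒< (0≤-≡ (upper (+ suc k) (+ s) q) (ℤP.i≤j⇒0≤j-i (proj₁ (/2-bounds X)))))
  where
  s : ℕ
  s = isqrt (5 ℕ.* (suc k ℕ.* suc k))
  X q : ℤ
  X = + suc k + + s
  q = X / + 2
  lower : ∀ v s q → (1ℤ + q) * + 2 - (v + s) - 1ℤ ≡ (- v + (- s - 1ℤ)) - (- q - 1ℤ) * + 2
  lower = solve-∀
  upper : ∀ v s q → v + s - q * + 2 ≡ (1ℤ + (- q - 1ℤ)) * + 2 - (- v + (- s - 1ℤ)) - 1ℤ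
  upper = solve-∀

-- Beatty's theorem for φ and φ²: with m = ⌊nφ⌋, according to the sign of
-- N (n + 1) (m + 1 - n), either n = ⌊(m + 1 - n)φ⌋ or n = ⌊jφ⌋ + j for j = n - (m - n).
floorVφ-complement : ∀ {n} → 0ℤ ℤ.< n →
  (Σ ℤ λ k → 0ℤ ℤ.< k × floorVφ k ≡ n) ⊎ (Σ ℤ λ k → 0ℤ ℤ.< k × floorVφ k + k ≡ n)
floorVφ-complement {n} 0<n = by-sign (0ℤ ℤ.<? N (n + 1ℤ) k)
  where
  m k : ℤ
  m = floorVφ n
  k = m + 1ℤ - n
  0<k : 0ℤ ℤ.< k
  0<k = 0≤⇒< (0≤-≡ (identity m n) (ℤP.i≤j⇒0≤j-i (≤floorVφ 0<n)))
    where
    identity : ∀ m n → m - n ≡ m + 1ℤ - n - 0ℤ - 1ℤ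
    identity = solve-∀
  Nn<0 : N n k ℤ.< 0ℤ
  Nn<0 = subst (ℤ._< 0ℤ) (sym (N-descent (m + 1ℤ) n))
    (ℤP.neg-mono-< (proj₂ (proj₂ (floorVφ-spec 0<n))))
  by-sign : Dec (0ℤ ℤ.< N (n + 1ℤ) k) →
    (Σ ℤ λ k → 0ℤ ℤ.< k × floorVφ k ≡ n) ⊎ (Σ ℤ λ k → 0ℤ ℤ.< k × floorVφ k + k ≡ n)
  by-sign (yes 0<N) = inj₁ (k , 0<k , floorVφ-unique 0<k (Nn<0 , 0<N))
  by-sign (no ¬0<N) = inj₂ (j , 0<j , trans (cong (_+ j) (floorVφ-unique {m = m - n} 0<j (Nc<0 , 0<N[c+1])))
                                           (identity m n))
    where
    j : ℤ
    j = n - (m - n)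
    identity : ∀ m n → (m - n) + (n - (m - n)) ≡ n
    identity = solve-∀
    0<j : 0ℤ ℤ.< j
    0<j = 0≤⇒< (0≤-≡ (identity₂ m n) (<⇒0≤ (floorVφ<2* 0<n)))
      where
      identity₂ : ∀ m n → n + n - m - 1ℤ ≡ n - (m - n) - 0ℤ - 1ℤ
      identity₂ = solve-∀
    Nc<0 : N (m - n) j ℤ.< 0ℤ
    Nc<0 = subst (ℤ._< 0ℤ)
      (sym (trans (N-descent n (m - n)) (trans (cong -_ (N-descent m n)) (ℤP.neg-involutive _))))
      (proj₁ (proj₂ (floorVφ-spec 0<n)))
    N<0 : N (n + 1ℤ) k ℤ.< 0ℤ
    N<0 = ℤP.≤∧≢⇒< (ℤP.≮⇒≥ ¬0<N) (N≢0 (0≤-+ (ℤP.<⇒≤ 0<n) (0≤+ 1)) 0<k)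
    0<N[c+1] : 0ℤ ℤ.< N (m - n + 1ℤ) j
    0<N[c+1] = subst (0ℤ ℤ.<_) (identity₃ m n) (ℤP.neg-mono-< N<0)
      where
      identity₃ : ∀ m n →
        - ((n + 1ℤ) * (n + 1ℤ) - (n + 1ℤ) * (m + 1ℤ - n) - (m + 1ℤ - n) * (m + 1ℤ - n))
          ≡ (m - n + 1ℤ) * (m - n + 1ℤ) - (m - n + 1ℤ) * (n - (m - n)) - (n - (m - n)) * (n - (m - n))
      identity₃ = solve-∀

data Class : Set where
  R₁₀ R₂₀ R₃₁ R₂₂ : Class

index : Class → ℕ
index R₁₀ = 1
index R₂₀ = 2
index R₃₁ = 3
index R₂₂ = 2

offset : Class → ℤ
offset R₁₀ = + 0
offset R₂₀ = + 0
offset R₃₁ = + 1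
offset R₂₂ = + 2

member : Class → ℕ → ℤ
member c = f (index c) (offset c)

-- f_{i,j}(k) and ⌊f_{i,j}(k) φ⌋ in terms of m = ⌊kφ⌋ and v = k.
form : Class → ℤ → ℤ → ℤ
form R₁₀ m v = m + v
form R₂₀ m v = + 2 * m + v
form R₃₁ m v = + 3 * m + + 2 * v - 1ℤ
form R₂₂ m v = + 2 * m + v - + 2

floor-form : Class → ℤ → ℤ → ℤ
floor-form R₁₀ m v = + 2 * m + v
floor-form R₂₀ m v = + 3 * m + + 2 * v - 1ℤ
floor-form R₃₁ m v = + 5 * m + + 3 * v - + 2
floor-form R₂₂ m v = + 3 * m + + 2 * v - + 4

member≡form : ∀ c k → member c k ≡ form c (floorVφ (+ k)) (+ k)
member≡form c k = trans (cong (λ m → + F (suc (index c)) * m + + F (index c) * + k - offset c)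
                              (ℤP.+-identityˡ (floorVφ (+ k))))
                        (expand c (floorVφ (+ k)) (+ k))
  where
  expand₁₀ : ∀ m v → + 1 * m + + 1 * v - + 0 ≡ m + v
  expand₁₀ = solve-∀
  expand₂₀ : ∀ m v → + 2 * m + + 1 * v - + 0 ≡ + 2 * m + v
  expand₂₀ = solve-∀
  expand₂₂ : ∀ m v → + 2 * m + + 1 * v - + 2 ≡ + 2 * m + v - + 2
  expand₂₂ = solve-∀
  expand : ∀ c m v → + F (suc (index c)) * m + + F (index c) * v - offset c ≡ form c m v
  expand R₁₀ = expand₁₀
  expand R₂₀ = expand₂₀
  expand R₃₁ _ _ = refl
  expand R₂₂ = expand₂₂

module _ {v : ℤ} (0<v : 0ℤ ℤ.< v) where
  private
    m : ℤ
    m = floorVφ v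
    0<m : 0ℤ ℤ.< m
    0<m = 0<floorVφ 0<v

  floorVφ-R₁₀ : floorVφ (m + v) ≡ + 2 * m + v
  floorVφ-R₁₀ = floorVφ-shift 0<v refl

  floorVφ-R₂₀ : floorVφ (+ 2 * m + v) ≡ + 3 * m + + 2 * v - 1ℤ
  floorVφ-R₂₀ = trans (floorVφ-compose (ℤP.+-mono-< 0<m 0<v) floorVφ-R₁₀) (identity m v)
    where
    identity : ∀ m v → + 2 * m + v + (m + v) - 1ℤ ≡ + 3 * m + + 2 * v - 1ℤ
    identity = solve-∀

  0<2m+v : 0ℤ ℤ.< + 2 * m + v
  0<2m+v = subst (0ℤ ℤ.<_) floorVφ-R₁₀ (0<floorVφ (ℤP.+-mono-< 0<m 0<v))

  floorVφ-R₃₁ : floorVφ (+ 3 * m + + 2 * v - 1ℤ) ≡ + 5 * m + + 3 * v - + 2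
  floorVφ-R₃₁ = trans (floorVφ-compose 0<2m+v floorVφ-R₂₀) (identity m v)
    where
    identity : ∀ m v → + 3 * m + + 2 * v - 1ℤ + (+ 2 * m + v) - 1ℤ ≡ + 5 * m + + 3 * v - + 2
    identity = solve-∀

  0<m+v-1 : 0ℤ ℤ.< m + v - 1ℤ
  0<m+v-1 = subst (0ℤ ℤ.<_) (floorVφ-compose 0<v refl) (0<floorVφ 0<m)

  floorVφ-m+v-1 : floorVφ (m + v - 1ℤ) ≡ + 2 * m + v - + 2
  floorVφ-m+v-1 = trans (floorVφ-compose 0<m (floorVφ-compose 0<v refl)) (identity m v)
    where
    identity : ∀ m v → m + v - 1ℤ + m - 1ℤ ≡ + 2 * m + v - + 2
    identity = solve-∀

  floorVφ-R₂₂ : floorVφ (+ 2 * m + v - + 2) ≡ + 3 * m + + 2 * v - + 4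
  floorVφ-R₂₂ = trans (floorVφ-compose 0<m+v-1 floorVφ-m+v-1) (identity m v)
    where
    identity : ∀ m v → + 2 * m + v - + 2 + (m + v - 1ℤ) - 1ℤ ≡ + 3 * m + + 2 * v - + 4
    identity = solve-∀

  0<form : ∀ c → 0ℤ ℤ.< form c m v
  0<form R₁₀ = ℤP.+-mono-< 0<m 0<v
  0<form R₂₀ = 0<2m+v
  0<form R₃₁ = subst (0ℤ ℤ.<_) floorVφ-R₂₀ (0<floorVφ 0<2m+v)
  0<form R₂₂ = subst (0ℤ ℤ.<_) floorVφ-m+v-1 (0<floorVφ 0<m+v-1)

  floorVφ-form : ∀ c → floorVφ (form c m v) ≡ floor-form c m v
  floorVφ-form R₁₀ = floorVφ-R₁₀
  floorVφ-form R₂₀ = floorVφ-R₂₀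
  floorVφ-form R₃₁ = floorVφ-R₃₁
  floorVφ-form R₂₂ = floorVφ-R₂₂

member-pos : ∀ c {k n} → 1 ≤ k → member c k ≡ + n → 1 ≤ n
member-pos c {k} 1≤k eq =
  ℤP.drop‿+<+ (subst (0ℤ ℤ.<_) (trans (sym (member≡form c k)) eq) (0<form (+<+ 1≤k) c))

formula-at-member : ∀ c c′ {k n} (g : ℤ → ℤ → ℤ) → 1 ≤ k → member c k ≡ + n →
  g (form c (floorVφ (+ k)) (+ k)) (floor-form c (floorVφ (+ k)) (+ k)) ≡ form c′ (floorVφ (+ k)) (+ k) →
  g (+ n) (floorVφ (+ n)) ≡ member c′ k
formula-at-member c c′ {k} {n} g 1≤k eq identity = begin
  g (+ n) (floorVφ (+ n))           ≡⟨ cong₂ g (sym form≡n) (trans (cong floorVφ (sym form≡n))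
                                                                   (floorVφ-form (+<+ 1≤k) c)) ⟩
  g (form c m v) (floor-form c m v) ≡⟨ identity ⟩
  form c′ m v                       ≡⟨ sym (member≡form c′ k) ⟩
  member c′ k                       ∎
  where
  open ≡-Reasoning
  m v : ℤ
  m = floorVφ (+ k)
  v = + k
  form≡n : form c m v ≡ + n
  form≡n = trans (sym (member≡form c k)) eq

next : Class → Class
next R₁₀ = R₂₀
next R₂₀ = R₃₁
next R₃₁ = R₂₂
next R₂₂ = R₁₀

cycle : ℕ → Class → Class
cycle zero    c = c
cycle (suc j) c = next (cycle j c)

cycle-4 : ∀ c → cycle 4 c ≡ c
cycle-4 R₁₀ = refl
cycle-4 R₂₀ = refl
cycle-4 R₃₁ = refl
cycle-4 R₂₂ = refl

h-formula : Class → ℤ → ℤ → ℤ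
h-formula R₁₀ _ ⌊nφ⌋ = + 0 + ⌊nφ⌋
h-formula R₂₀ _ ⌊nφ⌋ = + 0 + ⌊nφ⌋
h-formula R₃₁ n ⌊nφ⌋ = (- + 1 - n) + ⌊nφ⌋
h-formula R₂₂ n ⌊nφ⌋ = (+ 2 - n) + ⌊nφ⌋

h-formula-advances : ∀ c m v → h-formula c (form c m v) (floor-form c m v) ≡ form (next c) m v
h-formula-advances R₁₀ = identity
  where
  identity : ∀ m v → + 0 + (+ 2 * m + v) ≡ + 2 * m + v
  identity = solve-∀
h-formula-advances R₂₀ = identity
  where
  identity : ∀ m v → + 0 + (+ 3 * m + + 2 * v - 1ℤ) ≡ + 3 * m + + 2 * v - 1ℤ
  identity = solve-∀
h-formula-advances R₃₁ = identity
  where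
  identity : ∀ m v → (- + 1 - (+ 3 * m + + 2 * v - 1ℤ)) + (+ 5 * m + + 3 * v - + 2) ≡ + 2 * m + v - + 2
  identity = solve-∀
h-formula-advances R₂₂ = identity
  where
  identity : ∀ m v → (+ 2 - (+ 2 * m + v - + 2)) + (+ 3 * m + + 2 * v - + 4) ≡ m + v
  identity = solve-∀

-- R₁₀ is the complement of ⌊ℕ⁺φ⌋; splitting ⌊ℕ⁺φ⌋ = ⌊R₁₀φ⌋ ∪ ⌊⌊ℕ⁺φ⌋φ⌋ twice more gives
-- R₂₀ = ⌊R₁₀φ⌋, R₃₁ = ⌊R₂₀φ⌋ and R₂₂ = ⌊⌊⌊ℕ⁺φ⌋φ⌋φ⌋.
forms-cover : ∀ {n} → 0ℤ ℤ.< n → Σ Class λ c → Σ ℤ λ v → 0ℤ ℤ.< v × form c (floorVφ v) v ≡ n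
forms-cover 0<n with floorVφ-complement 0<n
... | inj₂ (v , 0<v , eq) = R₁₀ , v , 0<v , eq
... | inj₁ (j , 0<j , ⌊j⌋≡n) with floorVφ-complement 0<j
...   | inj₂ (v , 0<v , eq) =
        R₂₀ , v , 0<v , trans (sym (floorVφ-R₁₀ 0<v)) (trans (cong floorVφ eq) ⌊j⌋≡n)
...   | inj₁ (i , 0<i , ⌊i⌋≡j) with floorVφ-complement 0<i
...     | inj₂ (v , 0<v , eq) =
          R₃₁ , v , 0<v , trans (sym (floorVφ-R₂₀ 0<v)) (trans (cong floorVφ 2m+v≡j) ⌊j⌋≡n)
  where
  2m+v≡j : + 2 * floorVφ v + v ≡ j
  2m+v≡j = trans (sym (floorVφ-R₁₀ 0<v)) (trans (cong floorVφ eq) ⌊i⌋≡j)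
...     | inj₁ (v , 0<v , ⌊v⌋≡i) =
          R₂₂ , v , 0<v , trans (sym (floorVφ-m+v-1 0<v)) (trans (cong floorVφ m+v-1≡j) ⌊j⌋≡n)
  where
  m+v-1≡j : floorVφ v + v - 1ℤ ≡ j
  m+v-1≡j = trans (sym (floorVφ-compose 0<v refl)) (trans (cong floorVφ ⌊v⌋≡i) ⌊i⌋≡j)

members-cover : ∀ {n} → 1 ≤ n → Σ Class λ c → Σ ℕ λ k → 1 ≤ k × member c k ≡ + n
members-cover 1≤n with forms-cover (+<+ 1≤n)
... | c , + zero    , +<+ () , _
... | c , + suc k , _      , eq = c , suc k , s≤s z≤n , trans (member≡form c (suc k)) eq

module Cycle (h : ℕ → ℕ)
  (H : ∀ n → 1 ≤ n →
        ((R 2 (+ 0) (+ n) ⊎ R 1 (+ 0) (+ n)) → + h n ≡ ⌊ + 0 + + n φ⌋)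
      × (R 2 (+ 2) (+ n) → + h n ≡ ⌊ (+ 2 - + n) + + n φ⌋)
      × (R 3 (+ 1) (+ n) → + h n ≡ ⌊ (- + 1 - + n) + + n φ⌋)) where

  h≡h-formula : ∀ c {n} → 1 ≤ n → R (index c) (offset c) (+ n) →
    + h n ≡ h-formula c (+ n) (floorVφ (+ n))
  h≡h-formula R₁₀ 1≤n r = proj₁ (H _ 1≤n) (inj₂ r)
  h≡h-formula R₂₀ 1≤n r = proj₁ (H _ 1≤n) (inj₁ r)
  h≡h-formula R₃₁ 1≤n r = proj₂ (proj₂ (H _ 1≤n)) r
  h≡h-formula R₂₂ 1≤n r = proj₁ (proj₂ (H _ 1≤n)) r

  h-step : ∀ c {k n} → 1 ≤ k → member c k ≡ + n → member (next c) k ≡ + h n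
  h-step c {k} 1≤k eq = sym (trans (h≡h-formula c (member-pos c 1≤k eq) (k , 1≤k , eq))
    (formula-at-member c (next c) (h-formula c) 1≤k eq (h-formula-advances c _ _)))

  h-orbit : ∀ j c {k n} → 1 ≤ k → member c k ≡ + n → member (cycle j c) k ≡ + (h ^ j) n
  h-orbit zero    c 1≤k eq = eq
  h-orbit (suc j) c 1≤k eq = h-step (cycle j c) 1≤k (h-orbit j c 1≤k eq)

  h-positive : ∀ n → 1 ≤ n → 1 ≤ h n
  h-positive n 1≤n with members-cover 1≤n
  ... | c , k , 1≤k , eq = member-pos (next c) 1≤k (h-step c 1≤k eq)

  h⁴≡id : ∀ n → 1 ≤ n → (h ^ 4) n ≡ n
  h⁴≡id n 1≤n with members-cover 1≤n
  ... | c , k , 1≤k , eq =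
    ℤP.+-injective (trans (sym (h-orbit 4 c 1≤k eq)) (trans (cong (λ c → member c k) (cycle-4 c)) eq))

  h^-formula : ∀ j c (g : ℤ → ℤ → ℤ) →
    (∀ m v → g (form c m v) (floor-form c m v) ≡ form (cycle j c) m v) →
    ∀ {n} → R (index c) (offset c) (+ n) → + (h ^ j) n ≡ g (+ n) (floorVφ (+ n))
  h^-formula j c g identity (k , 1≤k , eq) =
    sym (trans (formula-at-member c (cycle j c) g 1≤k eq (identity _ _)) (h-orbit j c 1≤k eq))

  -- 2 = f_{1,0}(1), so h²(2) = f_{3,1}(1).
  h²[2]≡4 : (h ^ 2) 2 ≡ 4
  h²[2]≡4 = ℤP.+-injective (sym (h-orbit 2 R₁₀ {k = 1} {n = 2} (s≤s z≤n) refl))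

  h²-formulas : ∀ n → 1 ≤ n →
      (R 1 (+ 0) (+ n) → + (h ^ 2) n ≡ ⌊ (+ n - + 1) + + n φ⌋)
    × (R 2 (+ 2) (+ n) → + (h ^ 2) n ≡ + n Data.Integer.+ + 2)
    × (R 2 (+ 0) (+ n) → + (h ^ 2) n ≡ + n - + 2)
    × (R 3 (+ 1) (+ n) → + (h ^ 2) n ≡ ⌊ (+ 2 Data.Integer.* + n Data.Integer.+ + 1) + - + n φ⌋)
  h²-formulas n 1≤n =
      h^-formula 2 R₁₀ (λ n ⌊nφ⌋ → (n - + 1) + ⌊nφ⌋) on-R₁₀
    , h^-formula 2 R₂₂ (λ n _ → n + + 2) on-R₂₂
    , h^-formula 2 R₂₀ (λ n _ → n - + 2) on-R₂₀
    , λ r → trans (h^-formula 2 R₃₁ (λ n ⌊nφ⌋ → (+ 2 * n + + 1) + (- ⌊nφ⌋ - 1ℤ)) on-R₃₁ r)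
                  (cong (λ x → (+ 2 * + n + + 1) + x) (sym (floorVφ-neg (+<+ 1≤n))))
    where
    on-R₁₀ : ∀ m v → (m + v - + 1) + (+ 2 * m + v) ≡ + 3 * m + + 2 * v - 1ℤ
    on-R₁₀ = solve-∀
    on-R₂₂ : ∀ m v → (+ 2 * m + v - + 2) + + 2 ≡ + 2 * m + v
    on-R₂₂ = solve-∀
    on-R₂₀ : ∀ m v → (+ 2 * m + v) - + 2 ≡ + 2 * m + v - + 2
    on-R₂₀ = solve-∀
    on-R₃₁ : ∀ m v →
      (+ 2 * (+ 3 * m + + 2 * v - 1ℤ) + + 1) + (- (+ 5 * m + + 3 * v - + 2) - 1ℤ) ≡ m + v
    on-R₃₁ = solve-∀

  h³-formulas : ∀ n →
      (R 2 (+ 2) (+ n) → + (h ^ 3) n ≡ ⌊ + 3 + + n φ⌋)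
    × (R 1 (+ 0) (+ n) → + (h ^ 3) n ≡ ⌊ - + 2 + + n φ⌋)
    × ((R 3 (+ 1) (+ n) ⊎ R 2 (+ 0) (+ n)) → + (h ^ 3) n ≡ ⌊ (+ 1 - + n) + + n φ⌋)
  h³-formulas n =
      h^-formula 3 R₂₂ (λ _ ⌊nφ⌋ → + 3 + ⌊nφ⌋) on-R₂₂
    , h^-formula 3 R₁₀ (λ _ ⌊nφ⌋ → - + 2 + ⌊nφ⌋) on-R₁₀
    , λ { (inj₁ r) → h^-formula 3 R₃₁ (λ n ⌊nφ⌋ → (+ 1 - n) + ⌊nφ⌋) on-R₃₁ r
        ; (inj₂ r) → h^-formula 3 R₂₀ (λ n ⌊nφ⌋ → (+ 1 - n) + ⌊nφ⌋) on-R₂₀ r }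
    where
    on-R₂₂ : ∀ m v → + 3 + (+ 3 * m + + 2 * v - + 4) ≡ + 3 * m + + 2 * v - 1ℤ
    on-R₂₂ = solve-∀
    on-R₁₀ : ∀ m v → - + 2 + (+ 2 * m + v) ≡ + 2 * m + v - + 2
    on-R₁₀ = solve-∀
    on-R₃₁ : ∀ m v → (+ 1 - (+ 3 * m + + 2 * v - 1ℤ)) + (+ 5 * m + + 3 * v - + 2) ≡ + 2 * m + v
    on-R₃₁ = solve-∀
    on-R₂₀ : ∀ m v → (+ 1 - (+ 2 * m + v)) + (+ 3 * m + + 2 * v - 1ℤ) ≡ m + v
    on-R₂₀ = solve-∀

theorem4p3 : (h : ℕ → ℕ) →
    (∀ n → 1 ≤ n →
        ((R 2 (+ 0) (+ n) ⊎ R 1 (+ 0) (+ n)) → + h n ≡ ⌊ + 0 + + n φ⌋)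
      × (R 2 (+ 2) (+ n) → + h n ≡ ⌊ (+ 2 - + n) + + n φ⌋)
      × (R 3 (+ 1) (+ n) → + h n ≡ ⌊ (- + 1 - + n) + + n φ⌋)) →
    ( (∀ n → 1 ≤ n → 1 ≤ h n)
    × (∀ m n → 1 ≤ m → 1 ≤ n → h m ≡ h n → m ≡ n)
    × (∀ m → 1 ≤ m → Σ ℕ (λ n → 1 ≤ n × h n ≡ m)) )
    × (∀ n → 1 ≤ n → (h ^ 4) n ≡ n)
    × Σ ℕ (λ n → 1 ≤ n × (h ^ 2) n ≢ n)
    × (∀ n → 1 ≤ n →
        (R 1 (+ 0) (+ n) → + (h ^ 2) n ≡ ⌊ (+ n - + 1) + + n φ⌋)
      × (R 2 (+ 2) (+ n) → + (h ^ 2) n ≡ + n Data.Integer.+ + 2)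
      × (R 2 (+ 0) (+ n) → + (h ^ 2) n ≡ + n - + 2)
      × (R 3 (+ 1) (+ n) → + (h ^ 2) n ≡ ⌊ (+ 2 Data.Integer.* + n Data.Integer.+ + 1) + - + n φ⌋))
    × (∀ n → 1 ≤ n →
        (h ((h ^ 3) n) ≡ n × (h ^ 3) (h n) ≡ n)
      × (R 2 (+ 2) (+ n) → + (h ^ 3) n ≡ ⌊ + 3 + + n φ⌋)
      × (R 1 (+ 0) (+ n) → + (h ^ 3) n ≡ ⌊ - + 2 + + n φ⌋)
      × ((R 3 (+ 1) (+ n) ⊎ R 2 (+ 0) (+ n)) → + (h ^ 3) n ≡ ⌊ (+ 1 - + n) + + n φ⌋))
theorem4p3 h H =
    (h-positive , injective , surjective)
  , h⁴≡id
  , (2 , s≤s z≤n , h²[2]≢2)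
  , h²-formulas
  , λ n 1≤n → (h⁴≡id n 1≤n , h⁴≡id n 1≤n) , h³-formulas n
  where
  open Cycle h H
  injective : ∀ m n → 1 ≤ m → 1 ≤ n → h m ≡ h n → m ≡ n
  injective m n 1≤m 1≤n hm≡hn =
    trans (sym (h⁴≡id m 1≤m)) (trans (cong (h ^ 3) hm≡hn) (h⁴≡id n 1≤n))
  surjective : ∀ m → 1 ≤ m → Σ ℕ (λ n → 1 ≤ n × h n ≡ m)
  surjective m 1≤m = (h ^ 3) m , h-positive _ (h-positive _ (h-positive m 1≤m)) , h⁴≡id m 1≤m
  h²[2]≢2 : (h ^ 2) 2 ≢ 2
  h²[2]≢2 h²2≡2 with trans (sym h²[2]≡4) h²2≡2
  ... | ()
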